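{- Let $G$ be a graph and $k\ge0$ an integer. If at some point of the game, after a cop move, the cop has $k$-cornered the robber or has $(k+1)$-caught the robber, then the cop can guarantee a win in at most $k$ more moves.
   Context: All graphs are finite, nonempty and reflexive (every vertex adjacent to itself). For distinct vertices $v,w$ of a graph $H$: $w$ corners $v$ in $H$ if every vertex of $H$ adjacent to $v$ is adjacent to $w$; $w$ strictly corners $v$ in $H$ if moreover some vertex of $H$ adjacent to $w$ is not adjacent to $v$; a strict corner of $H$ is a vertex strictly cornered in $H$ by another vertex. We also say $c$ corners $x$ in $H$ when $c=x$. Corner ranking: $G_1=G$, $k=1$. If $G_k$ is a clique, its vertices get rank $k$; stop. Else if $G_k$ has no strict corners, its vertices get rank $\infty$; stop. Else the set $X$ of strict corners of $G_k$ gets rank $k$, $G_{k+1}=G_k-X$, increase $k$, repeat. $\mathrm{cr}(v)$ is the rank of $v$. Projections: for $k$ with $G_{k+1}$ defined, $f_k(\{u\})=\{u\}$ if $\mathrm{cr}(u)>k$, otherwise the set of vertices of $G_{k+1}$ that strictly corner $u$ in $G_k$ ($u\in V(G_k)$); $f_k(S)=\bigcup_{u\in S}f_k(\{u\})$; $F_1$ the identity on nonempty subsets of $V(G)$, $F_k=f_{k-1}\circ\cdots\circ f_1$, $F_k(v)=F_k(\{v\})$. Game: cop places, robber places, then alternate moves with the cop first; a move is staying or moving to an adjacent vertex; cop wins when both share a vertex. With the cop at $c$ and robber at $x$: $x$ is $0$-cornered by $c$ if $c=x$; for $k\ge1$, $x$ is $k$-cornered by $c$ if some $x'\in F_k(x)$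 is cornered by $c$ in the subgraph induced by $V(G_k)\cup\{c\}$. For $k\ge1$, the cop has $k$-caught the robber if $c\in F_k(x)$. -}

module Defs where

open import Data.Nat using (ℕ; zero; suc; _<_)
open import Data.Fin using (Fin)
open import Data.Product using (Σ; ∃; _×_; _,_)
open import Data.Sum using (_⊎_)
open import Data.Empty using (⊥)
open import Data.Unit using (⊤)
open import Relation.Nullary using (¬_)
open import Relation.Binary using (Decidable)
open import Relation.Binary.PropositionalEquality using (_≡_; _≢_)

record Graph : Set₁ where
  field
    n        : ℕ
    nonempty : 0 < n
    Adj      : Fin n → Fin n → Set
    adj?     : Decidable Adj
    adj-refl : ∀ v → Adj v v
    adj-sym  : ∀ {u v} → Adj u v → Adj v u

module _ (G : Graph) where
  open Graph G

  Vertex : Set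
  Vertex = Fin n

  -- a set of vertices (the vertex set of an induced subgraph)
  VSet : Set₁
  VSet = Vertex → Set

  Corners : VSet → Vertex → Vertex → Set
  Corners H w v = H w × H v × (∀ u → H u → Adj u v → Adj u w)

  StrictlyCorners : VSet → Vertex → Vertex → Set
  StrictlyCorners H w v =
    w ≢ v × Corners H w v × (∃ λ u → H u × Adj u w × ¬ Adj u v)

  StrictCorner : VSet → Vertex → Set
  StrictCorner H v = H v × (∃ λ w → H w × StrictlyCorners H w v)

  -- convention: c corners x also when c = x
  CornersIncl : VSet → Vertex → Vertex → Set
  CornersIncl H c x = c ≡ x ⊎ Corners H c x

  IsClique : VSet → Set
  IsClique H = ∀ u v → H u → H v → Adj u v

  -- Corner ranking. Internal index: Gs i is the vertex set of G_{i+1}.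
  Gs : ℕ → VSet
  Gs zero    = λ _ → ⊤
  Gs (suc i) = λ v → Gs i v × ¬ StrictCorner (Gs i) v

  -- Defined i : the graph G_{i+1} is defined by the ranking process, i.e.
  -- every earlier G_{j+1} (j < i) was not a clique and had strict corners.
  Defined : ℕ → Set
  Defined i = ∀ j → j < i → ¬ IsClique (Gs j) × (∃ λ v → StrictCorner (Gs j) v)

  -- Projection f_{i+1} as a relation: w ∈ f_{i+1}({u}).
  -- cr(u) > i+1 holds exactly when u ∈ V(G_{i+2}) (G_{i+2} being defined).
  f : ℕ → Vertex → Vertex → Set
  f i u w = (Gs (suc i) u × w ≡ u)
          ⊎ (¬ Gs (suc i) u × Gs (suc i) w × StrictlyCorners (Gs i) w u)

  -- Fs i v w : w ∈ F_{i+1}(v)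
  Fs : ℕ → Vertex → Vertex → Set
  Fs zero    v w = w ≡ v
  Fs (suc i) v w = ∃ λ u → Fs i v u × f i u w

  -- x is k-cornered by c (cop at c, robber at x)
  KCornered : ℕ → Vertex → Vertex → Set
  KCornered zero    c x = c ≡ x
  KCornered (suc i) c x =
    Defined i × (∃ λ x' → Fs i x x' × CornersIncl (λ u → Gs i u ⊎ u ≡ c) c x')

  KCaught : ℕ → Vertex → Vertex → Set
  KCaught zero    c x = ⊥
  KCaught (suc i) c x = Defined i × Fs i x c

  -- CopWinsWithin k c x : with the cop at c, the robber at x and the robber
  -- to move, the cop can force a win within at most k more (cop) moves.
  CopWinsWithin : ℕ → Vertex → Vertex → Set
  CopWinsWithin zero    c x = c ≡ x
  CopWinsWithin (suc k) c x =
    c ≡ x ⊎ (∀ x' → Adj x x' → ∃ λ c' → Adj c c' × CopWinsWithin k c' x')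

-- Strict cornering is a strict partial order on the finitely many vertices,
-- so every strict corner of G_k is strictly cornered by a vertex surviving
-- into G_{k+1}. Hence the projection F_k maps every vertex to a nonempty set,
-- and a robber move x → y can be followed in the projection: for x' ∈ F_k(x)
-- there is y' ∈ F_k(y) adjacent to x'. If the cop corners x' in G_k ∪ {c},
-- he can step onto such a y', after which he has k-caught the robber; and
-- k-caught implies (k-1)-cornered.
module Submission where

open import Defs
open import Data.Nat using (ℕ; suc)
open import Data.Sum using (_⊎_)

open import Data.Nat using (zero)
open import Data.Nat.Properties using (m<n⇒m<1+n)
open import Data.Fin.Properties using (_≟_; all?; any?)
open import Data.Fin.Induction using (spo-noetherian; Acc; acc)
open import Data.Product using (∃; _×_; _,_)
open import Data.Sum using (inj₁; inj₂)
open import Data.Unit using (tt)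
open import Function using (id; flip)
open import Relation.Binary.Structures using (IsStrictPartialOrder)
open import Relation.Binary.PropositionalEquality using (_≡_; refl; isEquivalence; resp₂)
open import Relation.Nullary using (¬_; Dec; yes; no)
open import Relation.Nullary.Decidable using (_×-dec_; _→-dec_; ¬?)
open import Relation.Unary using (Decidable)

module _ (G : Graph) where
  open Graph G

  corners? : ∀ {H} → Decidable H → ∀ w v → Dec (Corners G H w v)
  corners? H? w v =
    H? w ×-dec H? v ×-dec all? (λ u → H? u →-dec adj? u v →-dec adj? u w)

  strictlyCorners? : ∀ {H} → Decidable H → ∀ w v → Dec (StrictlyCorners G H w v)
  strictlyCorners? H? w v =
    ¬? (w ≟ v) ×-dec corners? H? w v
      ×-dec any? (λ u → H? u ×-dec adj? u w ×-dec ¬? (adj? u v))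

  strictCorner? : ∀ {H} → Decidable H → Decidable (StrictCorner G H)
  strictCorner? H? v = H? v ×-dec any? (λ w → H? w ×-dec strictlyCorners? H? w v)

  Gs? : ∀ i → Decidable (Gs G i)
  Gs? zero    v = yes tt
  Gs? (suc i) v = Gs? i v ×-dec ¬? (strictCorner? (Gs? i) v)

  strictlyCorners-trans : ∀ {H u v w} →
    StrictlyCorners G H v u → StrictlyCorners G H w v → StrictlyCorners G H w u
  strictlyCorners-trans (_ , (_ , Hu , v≥u) , (t , Ht , t~v , t≁u))
                        (_ , (Hw , _ , w≥v) , _) =
    (λ { refl → t≁u (w≥v t Ht t~v) }) ,
    (Hw , Hu , λ s Hs s~u → w≥v s Hs (v≥u s Hs s~u)) ,
    (t , Ht , w≥v t Ht t~v , t≁u)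

  strictlyCornered-isStrictPartialOrder : ∀ H →
    IsStrictPartialOrder _≡_ (flip (StrictlyCorners G H))
  strictlyCornered-isStrictPartialOrder H = record
    { isEquivalence = isEquivalence
    ; irrefl        = λ { refl (v≢v , _) → v≢v refl }
    ; trans         = strictlyCorners-trans
    ; <-resp-≈      = resp₂ (flip (StrictlyCorners G H))
    }

  strictCorner⇒strictlyCornered-by-nonCorner : ∀ {H} → Decidable H → ∀ {v} →
    StrictCorner G H v →
    ∃ λ w → (H w × ¬ StrictCorner G H w) × StrictlyCorners G H w v
  strictCorner⇒strictlyCornered-by-nonCorner {H} H? (_ , w , _ , w>v) =
    climb (spo-noetherian (strictlyCornered-isStrictPartialOrder H) w) w>v
    where
    climb : ∀ {v w} → Acc (StrictlyCorners G H) w → StrictlyCorners G H w v →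
            ∃ λ w → (H w × ¬ StrictCorner G H w) × StrictlyCorners G H w v
    climb {w = w} (acc rs) w>v@(_ , (Hw , _) , _) with strictCorner? H? w
    ... | no  w-noncorner        = w , (Hw , w-noncorner) , w>v
    ... | yes (_ , w' , _ , w'>w) = climb (rs w'>w) (strictlyCorners-trans w>v w'>w)

  f-dominates : ∀ i {u w} → f G i u w →
    Gs G (suc i) w × (∀ t → Gs G i t → Adj t u → Adj t w)
  f-dominates i (inj₁ (Gu , refl))                       = Gu , λ _ _ → id
  f-dominates i (inj₂ (_ , Gw , (_ , (_ , _ , w≥u) , _))) = Gw , w≥u

  f-nonempty : ∀ i {v} → Gs G i v → ∃ (f G i v)
  f-nonempty i {v} Gv with strictCorner? (Gs? i) v
  ... | no  v-noncorner = v , inj₁ ((Gv , v-noncorner) , refl)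
  ... | yes v-corner with strictCorner⇒strictlyCornered-by-nonCorner (Gs? i) v-corner
  ...   | w , Gw , w>v = w , inj₂ ((λ (_ , v-noncorner) → v-noncorner v-corner) , Gw , w>v)

  Fs⊆Gs : ∀ i {x x'} → Fs G i x x' → Gs G i x'
  Fs⊆Gs zero    _             = tt
  Fs⊆Gs (suc i) (_ , _ , u↦w) with f-dominates i u↦w
  ... | Gw , _ = Gw

  Fs-lift-Adj : ∀ i {x y x'} → Adj x y → Fs G i x x' →
    ∃ λ y' → Fs G i y y' × Adj x' y'
  Fs-lift-Adj zero    {y = y} x~y refl = y , refl , x~y
  Fs-lift-Adj (suc i) x~y (u , x↦u , u↦x') with Fs-lift-Adj i x~y x↦u
  ... | v , y↦v , u~v with f-nonempty i (Fs⊆Gs i y↦v)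
  ...   | w , v↦w with f-dominates i u↦x' | f-dominates i v↦w
  ...     | (Gx' , _) , x'≥u | _ , w≥v =
    w , (v , y↦v , v↦w) , w≥v _ Gx' (adj-sym (x'≥u _ (Fs⊆Gs i y↦v) (adj-sym u~v)))

  Defined-pred : ∀ i → Defined G (suc i) → Defined G i
  Defined-pred i defined j j<i = defined j (m<n⇒m<1+n j<i)

  caught⇒cornered : ∀ k {c x} → KCaught G (suc k) c x → KCornered G k c x
  caught⇒cornered zero    (_ , c≡x) = c≡x
  caught⇒cornered (suc i) {c} (defined , u , x↦u , u↦c) with f-dominates i u↦c
  ... | (Gc , _) , c≥u =
    Defined-pred i defined , u , x↦u , inj₂ (inj₁ Gc , inj₁ (Fs⊆Gs i x↦u) , c≥u′)
    where
    c≥u′ : ∀ t → Gs G i t ⊎ t ≡ c → Adj t u → Adj t c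
    c≥u′ t (inj₁ Gt)   = c≥u t Gt
    c≥u′ _ (inj₂ refl) = λ _ → adj-refl c

  cornersIncl-Adj : ∀ {H c x' y'} → CornersIncl G H c x' → H y' → Adj x' y' → Adj c y'
  cornersIncl-Adj (inj₁ refl)           _   x'~y' = x'~y'
  cornersIncl-Adj (inj₂ (_ , _ , c≥x')) Hy' x'~y' = adj-sym (c≥x' _ Hy' (adj-sym x'~y'))

  cornered⇒copWins : ∀ k {c x} → KCornered G k c x → CopWinsWithin G k c x
  cornered⇒copWins zero    c≡x = c≡x
  cornered⇒copWins (suc i) (defined , x' , x↦x' , c≥x') = inj₂ copReply
    where
    copReply : ∀ y → Adj _ y → ∃ λ c' → Adj _ c' × CopWinsWithin G i c' y
    copReply y x~y with Fs-lift-Adj i x~y x↦x'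
    ... | y' , y↦y' , x'~y' =
      y' , cornersIncl-Adj c≥x' (inj₁ (Fs⊆Gs i y↦y')) x'~y' ,
      cornered⇒copWins i (caught⇒cornered i (defined , y↦y'))

theorem4p9 : (G : Graph) (k : ℕ) (c x : Vertex G) →
    KCornered G k c x ⊎ KCaught G (suc k) c x →
    CopWinsWithin G k c x
theorem4p9 G k c x (inj₁ cornered) = cornered⇒copWins G k cornered
theorem4p9 G k c x (inj₂ caught)   = cornered⇒copWins G k (caught⇒cornered G k caught)
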